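{- Let $n\ge2$. Summed over all $\Pi\in S^3_n$, the total number of plateaux is $\frac{(2n-1)\,n!\,(n-1)!}{3}$, and the total number of ascents (which equals the total number of descents) is $\frac{(3n^2-5n+1)\,n!\,(n-1)!}{6}$.
   Context: $S_n$ is the set of permutations of $\{0,\dots,n-1\}$ in one-line notation; $S^3_n$ is the set of pairs $\Pi=(\pi^2,\pi^3)$ of elements of $S_n$, with elements (columns) $\Pi_j=(\pi^2_j,\pi^3_j)^T$ and level $\mathrm{lev}(\Pi_j)=\max\{\pi^2_j,\pi^3_j\}$. For $1\le i\le n-1$, index $i$ is a plateau if $\mathrm{lev}(\Pi_i)=\mathrm{lev}(\Pi_{i+1})$, an ascent if $\mathrm{lev}(\Pi_i)<\mathrm{lev}(\Pi_{i+1})$, and a descent if $\mathrm{lev}(\Pi_i)>\mathrm{lev}(\Pi_{i+1})$. -}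

module Defs where

open import Data.Nat using (ℕ; zero; suc; _+_; _*_; _⊔_; _<ᵇ_; _≡ᵇ_)
open import Data.Bool using (Bool; true; false; if_then_else_)
open import Data.Fin using (Fin; toℕ)
open import Data.Vec using (Vec; []; _∷_; lookup)
open import Data.List using (List; []; _∷_; concatMap; map; filter; allFin; length; cartesianProduct)
open import Data.Product using (_×_; _,_; proj₁; proj₂)
open import Data.List.Relation.Unary.Unique.Propositional using (Unique)
open import Data.List.Relation.Unary.Unique.DecPropositional using (unique?)
open import Data.Fin.Properties using (_≟_)
import Data.Vec as V
open import Data.Nat.ListAction using (sum)

allVecs : (n m : ℕ) → List (Vec (Fin n) m)
allVecs n zero = [] ∷ []
allVecs n (suc m) = concatMap (λ x → map (x ∷_) (allVecs n m)) (allFin n)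

-- S_n: permutations of {0,…,n-1} in one-line notation, i.e. the words of
-- length n over Fin n with pairwise distinct entries (enumerated as a list,
-- each permutation exactly once)
Perm : (n : ℕ) → List (Vec (Fin n) n)
Perm n = filter (λ v → unique? _≟_ (V.toList v)) (allVecs n n)

-- S^3_n : pairs Π = (π², π³) of permutations
S3 : (n : ℕ) → List (Vec (Fin n) n × Vec (Fin n) n)
S3 n = cartesianProduct (Perm n) (Perm n)

lev : {n : ℕ} → Vec (Fin n) n × Vec (Fin n) n → Fin n → ℕ
lev (p , q) j = toℕ (lookup p j) ⊔ toℕ (lookup q j)

levels : {n : ℕ} → Vec (Fin n) n × Vec (Fin n) n → List ℕ
levels {n} Π = map (lev Π) (allFin n)

-- count adjacent pairs (a, b) of a list satisfying a boolean relation;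
-- these are exactly the indices i with 1 ≤ i ≤ n-1 comparing columns i, i+1
countAdj : (ℕ → ℕ → Bool) → List ℕ → ℕ
countAdj r [] = 0
countAdj r (a ∷ []) = 0
countAdj r (a ∷ b ∷ xs) = (if r a b then 1 else 0) + countAdj r (b ∷ xs)

plateaux : {n : ℕ} → Vec (Fin n) n × Vec (Fin n) n → ℕ
plateaux Π = countAdj (λ a b → a ≡ᵇ b) (levels Π)

ascents : {n : ℕ} → Vec (Fin n) n × Vec (Fin n) n → ℕ
ascents Π = countAdj (λ a b → a <ᵇ b) (levels Π)

descents : {n : ℕ} → Vec (Fin n) n × Vec (Fin n) n → ℕ
descents Π = countAdj (λ a b → b <ᵇ a) (levels Π)

totalPlateaux totalAscents totalDescents : ℕ → ℕ
totalPlateaux n = sum (map plateaux (S3 n))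
totalAscents n = sum (map ascents (S3 n))
totalDescents n = sum (map descents (S3 n))

module Submission where

-- The contribution of an index i depends only on the columns Π_i and Π_{i+1}. In each
-- row these carry an ordered pair of distinct values, and every such pair (a, b) occurs in exactly
-- (n-2)! permutations: relabelling values by a transposition shows the count does not depend on
-- (a, b), and summing over all pairs gives n!. Hence each total is (n-1) ((n-2)!)² times the number
-- of column pairs (x, z), (y, w) with x ≠ y, z ≠ w whose levels stand in the relevant relation.
-- For plateaux with x < y, equal levels force z = y and w < y, so there are max(x, y) choices, and
-- Σ_{x≠y<n} max(x, y) = (2n-1) n (n-1) / 3. Swapping the two columns exchanges ascents and
-- descents, and plateaux + ascents + descents = (n-1) (n!)², which yields the ascent count.

open import Defs
open import Data.Nat using (ℕ; _≤_; _+_; _*_; _∸_)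
open import Data.Nat using (_!)
open import Data.Product using (_×_)
open import Relation.Binary.PropositionalEquality using (_≡_)

open import Algebra.Properties.CommutativeSemigroup using (interchange)
open import Data.Bool using (Bool; true; false; if_then_else_)
open import Data.Fin using (Fin; zero; suc; toℕ; fromℕ<; inject₁)
open import Data.Fin.Permutation using (Permutation′; _⟨$⟩ʳ_; _⟨$⟩ˡ_; inverseˡ; inverseʳ; transpose)
open import Data.Fin.Properties using (_≟_; toℕ-injective; toℕ-fromℕ<; toℕ<n; suc-injective)
open import Data.List using (List; []; _∷_; _++_; map; concatMap; filter; length; tabulate; allFin; cartesianProduct)
open import Data.List.Properties using (map-++; map-∘; map-tabulate; length-tabulate; length-map)
open import Data.List.Relation.Unary.All using (All; all?)
open import Data.List.Relation.Unary.AllPairs.Core using ([]; _∷_)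
open import Data.List.Relation.Unary.Unique.DecPropositional using (unique?)
open import Data.List.Relation.Unary.Unique.Propositional using (Unique)
import Data.List.Relation.Unary.Unique.Propositional.Properties as Unique
open import Data.Nat using (zero; suc; _<_; _⊔_; _⊓_; _≡ᵇ_; _<ᵇ_; s≤s; z≤n)
open import Data.Nat.ListAction using (sum)
open import Data.Nat.ListAction.Properties using (sum-++)
open import Data.Nat.Properties
  using ( +-identityʳ; +-assoc; +-comm; +-commutativeSemigroup; +-cancelʳ-≡
        ; *-identityʳ; *-zeroʳ; *-comm; *-assoc; *-distribˡ-+; *-cancelʳ-≡
        ; m+n∸n≡m; +-∸-assoc; n∸n≡0
        ; ≤-refl; ≤-trans; <⇒≤; <⇒≢; ≮⇒≥; <-cmp; <-irrefl; <-asym; <-≤-trans; n≤1+n; _<?_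
        ; ⊔-sel; m≤n⇒m⊔n≡n; m≥n⇒m⊔n≡m; m≤n⇒m⊓n≡m; m≥n⇒m⊓n≡n )
  renaming (_≟_ to _≟ℕ_)
open import Data.Nat.Tactic.RingSolver using (solve-∀)
open import Data.Product using (_,_)
open import Data.Sum using (inj₁; inj₂)
open import Data.Vec as V using (Vec; []; _∷_; lookup)
open import Data.Vec.Properties using (toList-map; lookup-map; length-toList)
import Data.Vec.Relation.Unary.All.Properties as VecAll
open import Data.Vec.Relation.Unary.AllPairs.Core using ([]; _∷_)
import Data.Vec.Relation.Unary.Unique.Propositional as Vec
open import Data.Vec.Relation.Unary.Unique.Propositional.Properties using (lookup-injective)
open import Function using (_∘_; id; flip; _⇔_; mk⇔)
open import Relation.Binary using (tri<; tri≈; tri>)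
open import Relation.Binary.PropositionalEquality
  using (_≢_; ≢-sym; refl; sym; trans; cong; cong₂; subst; module ≡-Reasoning)
open import Relation.Nullary using (¬_; Dec; yes; no; does; ¬?; _×-dec_; contradiction)
open import Relation.Nullary.Decidable using (does-⇔; dec-true; dec-false)
open import Relation.Unary using (Pred; Decidable)

private variable
  A B : Set

𝟙 : Bool → ℕ
𝟙 b = if b then 1 else 0

-- On ℕ, ⟦ m ≟ℕ n ⟧ and ⟦ m <? n ⟧ compute to 𝟙 (m ≡ᵇ n) and 𝟙 (m <ᵇ n), the relations used in Defs.
⟦_⟧ : {P : Set} → Dec P → ℕ
⟦ d ⟧ = 𝟙 (does d)

⟦⟧-⇔ : {P Q : Set} → P ⇔ Q → (p : Dec P) (q : Dec Q) → ⟦ p ⟧ ≡ ⟦ q ⟧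
⟦⟧-⇔ P⇔Q p q = cong 𝟙 (does-⇔ P⇔Q p q)

⟦⟧-* : {P Q : Set} (p : Dec P) (q : Dec Q) → ⟦ p ⟧ * ⟦ q ⟧ ≡ ⟦ p ×-dec q ⟧
⟦⟧-* p q with does p | does q
... | true  | true  = refl
... | true  | false = refl
... | false | _     = refl

⟦⟧-true : {P : Set} (p : Dec P) → P → ⟦ p ⟧ ≡ 1
⟦⟧-true p x = cong 𝟙 (dec-true p x)

⟦⟧-false : {P : Set} (p : Dec P) → ¬ P → ⟦ p ⟧ ≡ 0
⟦⟧-false p ¬x = cong 𝟙 (dec-false p ¬x)

⟦¬?⟧+⟦⟧ : {P : Set} (p : Dec P) → ⟦ ¬? p ⟧ + ⟦ p ⟧ ≡ 1
⟦¬?⟧+⟦⟧ p with does p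
... | true  = refl
... | false = refl

-- Finite sums

∑ : List A → (A → ℕ) → ℕ
∑ xs f = sum (map f xs)

syntax ∑ xs (λ x → e) = ∑[ x ∈ xs ] e

∑-cong : (xs : List A) {f g : A → ℕ} → (∀ x → f x ≡ g x) → ∑ xs f ≡ ∑ xs g
∑-cong []       f≗g = refl
∑-cong (x ∷ xs) f≗g = cong₂ _+_ (f≗g x) (∑-cong xs f≗g)

∑-distrib-+ : (xs : List A) (f g : A → ℕ) → ∑[ x ∈ xs ] (f x + g x) ≡ ∑ xs f + ∑ xs g
∑-distrib-+ []       f g = refl
∑-distrib-+ (x ∷ xs) f g = trans (cong (f x + g x +_) (∑-distrib-+ xs f g))
                                 (interchange +-commutativeSemigroup (f x) (g x) (∑ xs f) (∑ xs g))

∑-*ˡ : (xs : List A) (k : ℕ) (f : A → ℕ) → ∑[ x ∈ xs ] (k * f x) ≡ k * ∑ xs f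
∑-*ˡ []       k f = sym (*-zeroʳ k)
∑-*ˡ (x ∷ xs) k f = trans (cong (k * f x +_) (∑-*ˡ xs k f)) (sym (*-distribˡ-+ k (f x) (∑ xs f)))

∑-*ʳ : (xs : List A) (k : ℕ) (f : A → ℕ) → ∑[ x ∈ xs ] (f x * k) ≡ ∑ xs f * k
∑-*ʳ xs k f = trans (∑-cong xs (λ x → *-comm (f x) k)) (trans (∑-*ˡ xs k f) (*-comm k (∑ xs f)))

∑-const : (xs : List A) (c : ℕ) → ∑[ x ∈ xs ] c ≡ length xs * c
∑-const []       c = refl
∑-const (x ∷ xs) c = cong (c +_) (∑-const xs c)

∑-zero : (xs : List A) → ∑[ x ∈ xs ] 0 ≡ 0
∑-zero xs = trans (∑-const xs 0) (*-zeroʳ (length xs))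

∑-swap : (xs : List A) (ys : List B) (f : A → B → ℕ) →
         ∑[ x ∈ xs ] ∑[ y ∈ ys ] f x y ≡ ∑[ y ∈ ys ] ∑[ x ∈ xs ] f x y
∑-swap []       ys f = sym (∑-zero ys)
∑-swap (x ∷ xs) ys f = trans (cong (∑ ys (f x) +_) (∑-swap xs ys f))
                             (sym (∑-distrib-+ ys (f x) (λ y → ∑[ x ∈ xs ] f x y)))

∑-++ : (xs ys : List A) (f : A → ℕ) → ∑ (xs ++ ys) f ≡ ∑ xs f + ∑ ys f
∑-++ xs ys f = trans (cong sum (map-++ f xs ys)) (sum-++ (map f xs) (map f ys))

∑-map : (g : A → B) (xs : List A) (f : B → ℕ) → ∑ (map g xs) f ≡ ∑ xs (f ∘ g)
∑-map g xs f = cong sum (sym (map-∘ xs))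

∑-concatMap : (g : A → List B) (xs : List A) (f : B → ℕ) →
              ∑ (concatMap g xs) f ≡ ∑[ x ∈ xs ] ∑ (g x) f
∑-concatMap g []       f = refl
∑-concatMap g (x ∷ xs) f = trans (∑-++ (g x) (concatMap g xs) f) (cong (∑ (g x) f +_) (∑-concatMap g xs f))

∑-cartesianProduct : (xs : List A) (ys : List B) (f : A × B → ℕ) →
                     ∑ (cartesianProduct xs ys) f ≡ ∑[ x ∈ xs ] ∑[ y ∈ ys ] f (x , y)
∑-cartesianProduct []       ys f = refl
∑-cartesianProduct (x ∷ xs) ys f =
  trans (∑-++ (map (x ,_) ys) _ f) (cong₂ _+_ (∑-map (x ,_) ys f) (∑-cartesianProduct xs ys f))

∑-filter : {P : Pred A _} (P? : Decidable P) (xs : List A) (f : A → ℕ) →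
           ∑ (filter P? xs) f ≡ ∑[ x ∈ xs ] (⟦ P? x ⟧ * f x)
∑-filter P? []       f = refl
∑-filter P? (x ∷ xs) f with does (P? x)
... | true  = cong₂ _+_ (sym (+-identityʳ (f x))) (∑-filter P? xs f)
... | false = ∑-filter P? xs f

length≡∑1 : (xs : List A) → length xs ≡ ∑[ x ∈ xs ] 1
length≡∑1 xs = trans (sym (*-identityʳ (length xs))) (sym (∑-const xs 1))

∑< : (n : ℕ) → (Fin n → ℕ) → ℕ
∑< n = ∑ (allFin n)

syntax ∑< n (λ i → e) = ∑[ i < n ] e

∑<-suc : (n : ℕ) (f : Fin (suc n) → ℕ) → ∑[ i < suc n ] f i ≡ f zero + ∑[ i < n ] f (suc i)
∑<-suc n f = cong (f zero +_) (trans (cong (λ is → ∑ is f) (sym (map-tabulate id suc))) (∑-map suc (allFin n) f))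

∑<-const : (n c : ℕ) → ∑[ i < n ] c ≡ n * c
∑<-const n c = trans (∑-const (allFin n) c) (cong (_* c) (length-tabulate {n = n} id))

δ : {n : ℕ} → Fin n → Fin n → ℕ
δ x y = ⟦ x ≟ y ⟧

∑<-δ : (n : ℕ) (y : Fin n) (g : Fin n → ℕ) → ∑[ x < n ] (δ x y * g x) ≡ g y
∑<-δ (suc n) zero    g = trans (∑<-suc n (λ x → δ x zero * g x))
  (trans (cong₂ _+_ (+-identityʳ (g zero)) (∑-zero (allFin n))) (+-identityʳ (g zero)))
∑<-δ (suc n) (suc y) g = trans (∑<-suc n (λ x → δ x (suc y) * g x)) (∑<-δ n y (g ∘ suc))

∑ℕ : ℕ → (ℕ → ℕ) → ℕ
∑ℕ n f = ∑[ i < n ] f (toℕ i)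

syntax ∑ℕ n (λ x → e) = ∑ℕ[ x < n ] e

∑ℕ-cong : (n : ℕ) {f g : ℕ → ℕ} → (∀ x → x < n → f x ≡ g x) → ∑ℕ n f ≡ ∑ℕ n g
∑ℕ-cong n f≗g = ∑-cong (allFin n) (λ i → f≗g (toℕ i) (toℕ<n i))

∑ℕ-last : (n : ℕ) (f : ℕ → ℕ) → ∑ℕ[ x < suc n ] f x ≡ ∑ℕ[ x < n ] f x + f n
∑ℕ-last zero    f = +-identityʳ (f 0)
∑ℕ-last (suc n) f = begin
    ∑ℕ[ x < suc (suc n) ] f x
  ≡⟨ ∑<-suc (suc n) (f ∘ toℕ) ⟩
    f 0 + ∑ℕ[ x < suc n ] f (suc x)
  ≡⟨ cong (f 0 +_) (∑ℕ-last n (f ∘ suc)) ⟩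
    f 0 + (∑ℕ[ x < n ] f (suc x) + f (suc n))
  ≡⟨ +-assoc (f 0) _ (f (suc n)) ⟨
    f 0 + ∑ℕ[ x < n ] f (suc x) + f (suc n)
  ≡⟨ cong (_+ f (suc n)) (∑<-suc n (f ∘ toℕ)) ⟨
    ∑ℕ[ x < suc n ] f x + f (suc n)
  ∎ where open ≡-Reasoning

∑ℕ-δ : {y n : ℕ} → y < n → (g : ℕ → ℕ) → ∑ℕ[ z < n ] (⟦ y ≟ℕ z ⟧ * g z) ≡ g y
∑ℕ-δ {y} {n} y<n g = begin
    ∑ℕ[ z < n ] (⟦ y ≟ℕ z ⟧ * g z)
  ≡⟨ ∑-cong (allFin n) (λ z → cong (_* g (toℕ z)) (⟦⟧-⇔ (y≡⇔ z) (y ≟ℕ toℕ z) (z ≟ fromℕ< y<n))) ⟩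
    ∑[ z < n ] (δ z (fromℕ< y<n) * g (toℕ z))
  ≡⟨ ∑<-δ n (fromℕ< y<n) (g ∘ toℕ) ⟩
    g (toℕ (fromℕ< y<n))
  ≡⟨ cong g (toℕ-fromℕ< y<n) ⟩
    g y
  ∎ where
  open ≡-Reasoning
  y≡⇔ : (z : Fin n) → (y ≡ toℕ z) ⇔ (z ≡ fromℕ< y<n)
  y≡⇔ z = mk⇔ (λ y≡z → toℕ-injective (trans (sym y≡z) (sym (toℕ-fromℕ< y<n))))
              (λ z≡y → sym (trans (cong toℕ z≡y) (toℕ-fromℕ< y<n)))

∑ℕ-< : (n y : ℕ) → ∑ℕ[ w < n ] ⟦ w <? y ⟧ ≡ n ⊓ y
∑ℕ-< zero    y = refl
∑ℕ-< (suc n) y = trans (∑ℕ-last n (λ w → ⟦ w <? y ⟧)) (trans (cong (_+ ⟦ n <? y ⟧) (∑ℕ-< n y)) step)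
  where
  step : n ⊓ y + ⟦ n <? y ⟧ ≡ suc n ⊓ y
  step with <-cmp n y
  ... | tri< n<y _ _ = trans (cong (_+ ⟦ n <? y ⟧) (m≤n⇒m⊓n≡m (<⇒≤ n<y)))
                             (trans (cong (n +_) (⟦⟧-true (n <? y) n<y)) (trans (+-comm n 1) (sym (m≤n⇒m⊓n≡m n<y))))
  ... | tri≈ _ refl _ = trans (cong₂ _+_ (m≤n⇒m⊓n≡m (≤-refl {n})) (⟦⟧-false (n <? n) (<-irrefl refl)))
                              (trans (+-identityʳ n) (sym (m≥n⇒m⊓n≡n (n≤1+n n))))
  ... | tri> _ _ y<n = trans (cong₂ _+_ (m≥n⇒m⊓n≡n (<⇒≤ y<n)) (⟦⟧-false (n <? y) (<-asym y<n)))
                             (trans (+-identityʳ y) (sym (m≥n⇒m⊓n≡n (≤-trans (<⇒≤ y<n) (n≤1+n n)))))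

∑ℕ-distinct : (n : ℕ) → ∑ℕ[ x < n ] ∑ℕ[ y < n ] ⟦ ¬? (x ≟ℕ y) ⟧ ≡ n * (n ∸ 1)
∑ℕ-distinct n = trans (∑ℕ-cong n row) (∑<-const n (n ∸ 1))
  where
  open ≡-Reasoning
  row : ∀ x → x < n → ∑ℕ[ y < n ] ⟦ ¬? (x ≟ℕ y) ⟧ ≡ n ∸ 1
  row x x<n = begin
      ∑ℕ[ y < n ] ⟦ ¬? (x ≟ℕ y) ⟧
    ≡⟨ m+n∸n≡m _ 1 ⟨
      ∑ℕ[ y < n ] ⟦ ¬? (x ≟ℕ y) ⟧ + 1 ∸ 1
    ≡⟨ cong (λ k → ∑ℕ[ y < n ] ⟦ ¬? (x ≟ℕ y) ⟧ + k ∸ 1) (∑ℕ-δ x<n (λ _ → 1)) ⟨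
      ∑ℕ[ y < n ] ⟦ ¬? (x ≟ℕ y) ⟧ + ∑ℕ[ y < n ] (⟦ x ≟ℕ y ⟧ * 1) ∸ 1
    ≡⟨ cong (_∸ 1) (∑-distrib-+ (allFin n) _ _) ⟨
      ∑ℕ[ y < n ] (⟦ ¬? (x ≟ℕ y) ⟧ + ⟦ x ≟ℕ y ⟧ * 1) ∸ 1
    ≡⟨ cong (_∸ 1) (∑-cong (allFin n) (λ y → trans (cong (⟦ ¬? (x ≟ℕ toℕ y) ⟧ +_) (*-identityʳ _)) (⟦¬?⟧+⟦⟧ (x ≟ℕ toℕ y)))) ⟩
      ∑[ y < n ] 1 ∸ 1
    ≡⟨ cong (_∸ 1) (trans (∑<-const n 1) (*-identityʳ n)) ⟩
      n ∸ 1
    ∎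

-- Relabelling values by a permutation

distinct? : {n m : ℕ} (v : Vec (Fin n) m) → Dec (Unique (V.toList v))
distinct? v = unique? _≟_ (V.toList v)

module _ {n : ℕ} (π : Permutation′ n) where

  δ-inverse : (x y : Fin n) → δ y (π ⟨$⟩ʳ x) ≡ δ x (π ⟨$⟩ˡ y)
  δ-inverse x y = ⟦⟧-⇔ (mk⇔ (λ y≡πx → sym (trans (cong (π ⟨$⟩ˡ_) y≡πx) (inverseˡ π)))
                            (λ x≡π⁻¹y → trans (sym (inverseʳ π)) (cong (π ⟨$⟩ʳ_) (sym x≡π⁻¹y))))
                       (y ≟ π ⟨$⟩ʳ x) (x ≟ π ⟨$⟩ˡ y)

  ⟨$⟩ʳ-injective : {x y : Fin n} → π ⟨$⟩ʳ x ≡ π ⟨$⟩ʳ y → x ≡ y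
  ⟨$⟩ʳ-injective e = trans (sym (inverseˡ π)) (trans (cong (π ⟨$⟩ˡ_) e) (inverseˡ π))

  δ-permute : (x y : Fin n) → δ (π ⟨$⟩ʳ x) (π ⟨$⟩ʳ y) ≡ δ x y
  δ-permute x y = ⟦⟧-⇔ (mk⇔ ⟨$⟩ʳ-injective (cong (π ⟨$⟩ʳ_))) (π ⟨$⟩ʳ x ≟ π ⟨$⟩ʳ y) (x ≟ y)

  ∑<-permute : (h : Fin n → ℕ) → ∑[ x < n ] h (π ⟨$⟩ʳ x) ≡ ∑[ x < n ] h x
  ∑<-permute h = begin
      ∑[ x < n ] h (π ⟨$⟩ʳ x)
    ≡⟨ ∑-cong (allFin n) (λ x → sym (∑<-δ n (π ⟨$⟩ʳ x) h)) ⟩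
      ∑[ x < n ] ∑[ y < n ] (δ y (π ⟨$⟩ʳ x) * h y)
    ≡⟨ ∑-swap (allFin n) (allFin n) _ ⟩
      ∑[ y < n ] ∑[ x < n ] (δ y (π ⟨$⟩ʳ x) * h y)
    ≡⟨ ∑-cong (allFin n) (λ y → ∑-cong (allFin n) (λ x → cong (_* h y) (δ-inverse x y))) ⟩
      ∑[ y < n ] ∑[ x < n ] (δ x (π ⟨$⟩ˡ y) * h y)
    ≡⟨ ∑-cong (allFin n) (λ y → ∑<-δ n (π ⟨$⟩ˡ y) (λ _ → h y)) ⟩
      ∑[ y < n ] h y
    ∎ where open ≡-Reasoning

  ∑-allVecs-permute : (m : ℕ) (F : Vec (Fin n) m → ℕ) →
                      ∑[ v ∈ allVecs n m ] F (V.map (π ⟨$⟩ʳ_) v) ≡ ∑ (allVecs n m) F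
  ∑-allVecs-permute zero    F = refl
  ∑-allVecs-permute (suc m) F = begin
      ∑[ v ∈ allVecs n (suc m) ] F (V.map (π ⟨$⟩ʳ_) v)
    ≡⟨ ∑-concatMap (λ x → map (x ∷_) (allVecs n m)) (allFin n) _ ⟩
      ∑[ x < n ] ∑[ v ∈ map (x ∷_) (allVecs n m) ] F (V.map (π ⟨$⟩ʳ_) v)
    ≡⟨ ∑-cong (allFin n) (λ x → ∑-map (x ∷_) (allVecs n m) _) ⟩
      ∑[ x < n ] ∑[ v ∈ allVecs n m ] F ((π ⟨$⟩ʳ x) ∷ V.map (π ⟨$⟩ʳ_) v)
    ≡⟨ ∑-cong (allFin n) (λ x → ∑-allVecs-permute m (λ v → F ((π ⟨$⟩ʳ x) ∷ v))) ⟩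
      ∑[ x < n ] ∑[ v ∈ allVecs n m ] F ((π ⟨$⟩ʳ x) ∷ v)
    ≡⟨ ∑<-permute (λ y → ∑[ v ∈ allVecs n m ] F (y ∷ v)) ⟩
      ∑[ y < n ] ∑[ v ∈ allVecs n m ] F (y ∷ v)
    ≡⟨ ∑-cong (allFin n) (λ y → ∑-map (y ∷_) (allVecs n m) F) ⟨
      ∑[ y < n ] ∑ (map (y ∷_) (allVecs n m)) F
    ≡⟨ ∑-concatMap (λ y → map (y ∷_) (allVecs n m)) (allFin n) F ⟨
      ∑ (allVecs n (suc m)) F
    ∎ where open ≡-Reasoning

  distinct-permute : {m : ℕ} (v : Vec (Fin n) m) → ⟦ distinct? (V.map (π ⟨$⟩ʳ_) v) ⟧ ≡ ⟦ distinct? v ⟧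
  distinct-permute v = ⟦⟧-⇔
    (mk⇔ (λ u → Unique.map⁻ (subst Unique (toList-map _ v) u))
         (λ u → subst Unique (sym (toList-map _ v)) (Unique.map⁺ ⟨$⟩ʳ-injective u)))
    (distinct? (V.map (π ⟨$⟩ʳ_) v)) (distinct? v)

  ∑-Perm-permute : (F : Vec (Fin n) n → ℕ) → ∑[ p ∈ Perm n ] F (V.map (π ⟨$⟩ʳ_) p) ≡ ∑ (Perm n) F
  ∑-Perm-permute F = begin
      ∑[ p ∈ Perm n ] F (V.map (π ⟨$⟩ʳ_) p)
    ≡⟨ ∑-filter distinct? (allVecs n n) _ ⟩
      ∑[ v ∈ allVecs n n ] (⟦ distinct? v ⟧ * F (V.map (π ⟨$⟩ʳ_) v))
    ≡⟨ ∑-cong (allVecs n n) (λ v → cong (_* F (V.map (π ⟨$⟩ʳ_) v)) (distinct-permute v)) ⟨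
      ∑[ v ∈ allVecs n n ] (⟦ distinct? (V.map (π ⟨$⟩ʳ_) v) ⟧ * F (V.map (π ⟨$⟩ʳ_) v))
    ≡⟨ ∑-allVecs-permute n (λ v → ⟦ distinct? v ⟧ * F v) ⟩
      ∑[ v ∈ allVecs n n ] (⟦ distinct? v ⟧ * F v)
    ≡⟨ ∑-filter distinct? (allVecs n n) F ⟨
      ∑ (Perm n) F
    ∎ where open ≡-Reasoning

module _ {n : ℕ} (u v : Fin n) where

  transpose-fst : transpose u v ⟨$⟩ʳ u ≡ v
  transpose-fst rewrite dec-true (u ≟ u) refl = refl

  transpose-snd : transpose u v ⟨$⟩ʳ v ≡ u
  transpose-snd with v ≟ u
  ... | yes v≡u = v≡u
  ... | no _ rewrite dec-true (v ≟ v) refl = refl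

  transpose-other : {w : Fin n} → w ≢ u → w ≢ v → transpose u v ⟨$⟩ʳ w ≡ w
  transpose-other {w} w≢u w≢v rewrite dec-false (w ≟ u) w≢u | dec-false (w ≟ v) w≢v = refl

-- Counting permutations

fresh? : {n : ℕ} (x : Fin n) (xs : List (Fin n)) → Dec (All (λ y → ¬ x ≡ y) xs)
fresh? x xs = all? (λ y → ¬? (x ≟ y)) xs

∑-fresh : (n : ℕ) (xs : List (Fin n)) → Unique xs → ∑[ x < n ] ⟦ fresh? x xs ⟧ + length xs ≡ n
∑-fresh n []       []           = trans (+-identityʳ _) (trans (∑<-const n 1) (*-identityʳ n))
∑-fresh n (y ∷ ys) (y∉ys ∷ ys!) = begin
    ∑[ x < n ] ⟦ fresh? x (y ∷ ys) ⟧ + (1 + length ys)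
  ≡⟨ cong (λ k → ∑[ x < n ] ⟦ fresh? x (y ∷ ys) ⟧ + (k + length ys)) (∑<-δ n y (λ _ → 1)) ⟨
    ∑[ x < n ] ⟦ fresh? x (y ∷ ys) ⟧ + (∑[ x < n ] (δ x y * 1) + length ys)
  ≡⟨ +-assoc (∑[ x < n ] ⟦ fresh? x (y ∷ ys) ⟧) _ (length ys) ⟨
    ∑[ x < n ] ⟦ fresh? x (y ∷ ys) ⟧ + ∑[ x < n ] (δ x y * 1) + length ys
  ≡⟨ cong (_+ length ys) (∑-distrib-+ (allFin n) _ _) ⟨
    ∑[ x < n ] (⟦ fresh? x (y ∷ ys) ⟧ + δ x y * 1) + length ys
  ≡⟨ cong (_+ length ys) (∑-cong (allFin n) fresh-split) ⟩
    ∑[ x < n ] ⟦ fresh? x ys ⟧ + length ys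
  ≡⟨ ∑-fresh n ys ys! ⟩
    n
  ∎ where
  open ≡-Reasoning
  fresh-split : ∀ x → ⟦ fresh? x (y ∷ ys) ⟧ + δ x y * 1 ≡ ⟦ fresh? x ys ⟧
  fresh-split x with x ≟ y
  ... | yes refl rewrite dec-true (fresh? x ys) y∉ys = refl
  ... | no _     = +-identityʳ _

injectiveWords : (n m : ℕ) → ℕ
injectiveWords n m = ∑[ v ∈ allVecs n m ] ⟦ distinct? v ⟧

injectiveWords-suc : (n m : ℕ) → injectiveWords n (suc m) ≡ (n ∸ m) * injectiveWords n m
injectiveWords-suc n m = begin
    injectiveWords n (suc m)
  ≡⟨ ∑-concatMap (λ x → map (x ∷_) (allVecs n m)) (allFin n) _ ⟩
    ∑[ x < n ] ∑[ v ∈ map (x ∷_) (allVecs n m) ] ⟦ distinct? v ⟧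
  ≡⟨ ∑-cong (allFin n) (λ x → ∑-map (x ∷_) (allVecs n m) _) ⟩
    ∑[ x < n ] ∑[ v ∈ allVecs n m ] ⟦ distinct? (x ∷ v) ⟧
    -- unique? on x ∷ xs computes to fresh? x xs ×-dec unique? xs
  ≡⟨ ∑-cong (allFin n) (λ x → ∑-cong (allVecs n m) (λ v → ⟦⟧-* (fresh? x (V.toList v)) (distinct? v))) ⟨
    ∑[ x < n ] ∑[ v ∈ allVecs n m ] (⟦ fresh? x (V.toList v) ⟧ * ⟦ distinct? v ⟧)
  ≡⟨ ∑-swap (allFin n) (allVecs n m) _ ⟩
    ∑[ v ∈ allVecs n m ] ∑[ x < n ] (⟦ fresh? x (V.toList v) ⟧ * ⟦ distinct? v ⟧)
  ≡⟨ ∑-cong (allVecs n m) (λ v → ∑-*ʳ (allFin n) ⟦ distinct? v ⟧ _) ⟩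
    ∑[ v ∈ allVecs n m ] (∑[ x < n ] ⟦ fresh? x (V.toList v) ⟧ * ⟦ distinct? v ⟧)
  ≡⟨ ∑-cong (allVecs n m) fresh-count ⟩
    ∑[ v ∈ allVecs n m ] ((n ∸ m) * ⟦ distinct? v ⟧)
  ≡⟨ ∑-*ˡ (allVecs n m) (n ∸ m) _ ⟩
    (n ∸ m) * injectiveWords n m
  ∎ where
  open ≡-Reasoning
  fresh-count : ∀ v → ∑[ x < n ] ⟦ fresh? x (V.toList v) ⟧ * ⟦ distinct? v ⟧ ≡ (n ∸ m) * ⟦ distinct? v ⟧
  fresh-count v with distinct? v
  ... | no _   = trans (*-zeroʳ (∑[ x < n ] ⟦ fresh? x (V.toList v) ⟧)) (sym (*-zeroʳ (n ∸ m)))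
  ... | yes v! = cong (_* 1) (begin
      ∑[ x < n ] ⟦ fresh? x (V.toList v) ⟧
    ≡⟨ m+n∸n≡m _ m ⟨
      ∑[ x < n ] ⟦ fresh? x (V.toList v) ⟧ + m ∸ m
    ≡⟨ cong (λ k → ∑[ x < n ] ⟦ fresh? x (V.toList v) ⟧ + k ∸ m) (length-toList v) ⟨
      ∑[ x < n ] ⟦ fresh? x (V.toList v) ⟧ + length (V.toList v) ∸ m
    ≡⟨ cong (_∸ m) (∑-fresh n (V.toList v) v!) ⟩
      n ∸ m
    ∎)

injectiveWords-! : (n m : ℕ) → m ≤ n → injectiveWords n m * (n ∸ m) ! ≡ n !
injectiveWords-! n zero    _   = +-identityʳ (n !)
injectiveWords-! n (suc m) m<n = begin
    injectiveWords n (suc m) * (n ∸ suc m) !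
  ≡⟨ cong (_* (n ∸ suc m) !) (trans (injectiveWords-suc n m) (*-comm (n ∸ m) _)) ⟩
    injectiveWords n m * (n ∸ m) * (n ∸ suc m) !
  ≡⟨ *-assoc (injectiveWords n m) (n ∸ m) _ ⟩
    injectiveWords n m * ((n ∸ m) * (n ∸ suc m) !)
  ≡⟨ cong (λ k → injectiveWords n m * (k * (n ∸ suc m) !)) (+-∸-assoc 1 m<n) ⟩
    injectiveWords n m * (suc (n ∸ suc m)) !
  ≡⟨ cong (λ k → injectiveWords n m * k !) (+-∸-assoc 1 m<n) ⟨
    injectiveWords n m * (n ∸ m) !
  ≡⟨ injectiveWords-! n m (<⇒≤ m<n) ⟩
    n !
  ∎ where open ≡-Reasoning

length-Perm : (n : ℕ) → length (Perm n) ≡ n !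
length-Perm n = begin
    length (Perm n)
  ≡⟨ length≡∑1 (Perm n) ⟩
    ∑[ p ∈ Perm n ] 1
  ≡⟨ ∑-filter distinct? (allVecs n n) (λ _ → 1) ⟩
    ∑[ v ∈ allVecs n n ] (⟦ distinct? v ⟧ * 1)
  ≡⟨ ∑-cong (allVecs n n) (λ v → *-identityʳ ⟦ distinct? v ⟧) ⟩
    injectiveWords n n
  ≡⟨ *-identityʳ (injectiveWords n n) ⟨
    injectiveWords n n * 0 !
  ≡⟨ cong (λ k → injectiveWords n n * k !) (n∸n≡0 n) ⟨
    injectiveWords n n * (n ∸ n) !
  ≡⟨ injectiveWords-! n n ≤-refl ⟩
    n !
  ∎ where open ≡-Reasoning

-- Two positions of a permutation

Unique-toList⁻ : {m : ℕ} {v : Vec A m} → Unique (V.toList v) → Vec.Unique v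
Unique-toList⁻ {v = []}    []          = []
Unique-toList⁻ {v = x ∷ v} (x∉v ∷ v!) = VecAll.toList⁻ x∉v ∷ Unique-toList⁻ v!

∑-fibres₂ : {n : ℕ} (xs : List A) (g h : A → Fin n) (f : Fin n → Fin n → ℕ) →
            ∑[ x ∈ xs ] f (g x) (h x) ≡ ∑[ a < n ] ∑[ b < n ] (∑[ x ∈ xs ] (δ a (g x) * δ b (h x)) * f a b)
∑-fibres₂ {n = n} xs g h f = begin
    ∑[ x ∈ xs ] f (g x) (h x)
  ≡⟨ ∑-cong xs expand ⟩
    ∑[ x ∈ xs ] ∑[ a < n ] ∑[ b < n ] (δ a (g x) * δ b (h x) * f a b)
  ≡⟨ ∑-swap xs (allFin n) _ ⟩
    ∑[ a < n ] ∑[ x ∈ xs ] ∑[ b < n ] (δ a (g x) * δ b (h x) * f a b)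
  ≡⟨ ∑-cong (allFin n) (λ a → ∑-swap xs (allFin n) _) ⟩
    ∑[ a < n ] ∑[ b < n ] ∑[ x ∈ xs ] (δ a (g x) * δ b (h x) * f a b)
  ≡⟨ ∑-cong (allFin n) (λ a → ∑-cong (allFin n) (λ b → ∑-*ʳ xs (f a b) _)) ⟩
    ∑[ a < n ] ∑[ b < n ] (∑[ x ∈ xs ] (δ a (g x) * δ b (h x)) * f a b)
  ∎ where
  open ≡-Reasoning
  expand : ∀ x → f (g x) (h x) ≡ ∑[ a < n ] ∑[ b < n ] (δ a (g x) * δ b (h x) * f a b)
  expand x = begin
      f (g x) (h x)
    ≡⟨ ∑<-δ n (g x) (λ a → f a (h x)) ⟨
      ∑[ a < n ] (δ a (g x) * f a (h x))
    ≡⟨ ∑-cong (allFin n) (λ a → cong (δ a (g x) *_) (∑<-δ n (h x) (f a))) ⟨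
      ∑[ a < n ] (δ a (g x) * ∑[ b < n ] (δ b (h x) * f a b))
    ≡⟨ ∑-cong (allFin n) (λ a → ∑-*ˡ (allFin n) (δ a (g x)) _) ⟨
      ∑[ a < n ] ∑[ b < n ] (δ a (g x) * (δ b (h x) * f a b))
    ≡⟨ ∑-cong (allFin n) (λ a → ∑-cong (allFin n) (λ b → *-assoc (δ a (g x)) _ _)) ⟨
      ∑[ a < n ] ∑[ b < n ] (δ a (g x) * δ b (h x) * f a b)
    ∎

pairCount : {n : ℕ} (i j a b : Fin n) → ℕ
pairCount {n} i j a b = ∑[ p ∈ Perm n ] (δ a (lookup p i) * δ b (lookup p j))

module _ {n : ℕ} (i j : Fin n) where

  pairCount-permute : (π : Permutation′ n) (a b : Fin n) → pairCount i j (π ⟨$⟩ʳ a) (π ⟨$⟩ʳ b) ≡ pairCount i j a b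
  pairCount-permute π a b = sym (trans (∑-cong (Perm n) relabel) (∑-Perm-permute π F))
    where
    F : Vec (Fin n) n → ℕ
    F p = δ (π ⟨$⟩ʳ a) (lookup p i) * δ (π ⟨$⟩ʳ b) (lookup p j)
    relabel : ∀ p → δ a (lookup p i) * δ b (lookup p j) ≡ F (V.map (π ⟨$⟩ʳ_) p)
    relabel p rewrite lookup-map i (π ⟨$⟩ʳ_) p | lookup-map j (π ⟨$⟩ʳ_) p =
      sym (cong₂ _*_ (δ-permute π a (lookup p i)) (δ-permute π b (lookup p j)))

  pairCount-relabel₁ : {a a′ b : Fin n} → a ≢ b → a′ ≢ b → pairCount i j a b ≡ pairCount i j a′ b
  pairCount-relabel₁ {a} {a′} {b} a≢b a′≢b = trans (sym (pairCount-permute (transpose a a′) a b))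
    (cong₂ (pairCount i j) (transpose-fst a a′) (transpose-other a a′ (≢-sym a≢b) (≢-sym a′≢b)))

  pairCount-relabel₂ : {a b b′ : Fin n} → a ≢ b → a ≢ b′ → pairCount i j a b ≡ pairCount i j a b′
  pairCount-relabel₂ {a} {b} {b′} a≢b a≢b′ = trans (sym (pairCount-permute (transpose b b′) a b))
    (cong₂ (pairCount i j) (transpose-other b b′ a≢b a≢b′) (transpose-fst b b′))

  pairCount-diag : i ≢ j → (a : Fin n) → pairCount i j a a ≡ 0
  pairCount-diag i≢j a = trans (∑-filter distinct? (allVecs n n) _) (trans (∑-cong (allVecs n n) vanish) (∑-zero (allVecs n n)))
    where
    vanish : ∀ v → ⟦ distinct? v ⟧ * (δ a (lookup v i) * δ a (lookup v j)) ≡ 0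
    vanish v with distinct? v | a ≟ lookup v i | a ≟ lookup v j
    ... | no _   | _        | _        = refl
    ... | yes _  | no _     | _        = refl
    ... | yes _  | yes _    | no _     = refl
    ... | yes v! | yes a≡vi | yes a≡vj = contradiction (lookup-injective (Unique-toList⁻ v!) i j (trans (sym a≡vi) a≡vj)) i≢j

pairCount-const : {k : ℕ} (i j : Fin (2 + k)) {a b : Fin (2 + k)} → a ≢ b →
                  pairCount i j a b ≡ pairCount i j zero (suc zero)
pairCount-const i j {a} {b} a≢b with b ≟ zero | a ≟ suc zero
... | no b≢0    | _        = trans (pairCount-relabel₁ i j a≢b (≢-sym b≢0)) (pairCount-relabel₂ i j {b′ = suc zero} (≢-sym b≢0) (λ ()))
... | yes refl  | no a≢1   = trans (pairCount-relabel₂ i j a≢b a≢1) (pairCount-relabel₁ i j {a′ = zero} a≢1 (λ ()))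
... | yes refl  | yes refl = trans (sym (pairCount-permute i j (transpose zero (suc zero)) (suc zero) zero))
                                   (cong₂ (pairCount i j) (transpose-snd zero (suc zero)) (transpose-fst zero (suc zero)))

module _ {k : ℕ} (i j : Fin (2 + k)) (i≢j : i ≢ j) where

  private
    C : ℕ
    C = pairCount i j zero (suc zero)

  pairCount-distinct : (a b : Fin (2 + k)) →
                       pairCount i j a b ≡ pairCount i j zero (suc zero) * ⟦ ¬? (toℕ a ≟ℕ toℕ b) ⟧
  pairCount-distinct a b with a ≟ b
  ... | yes refl = trans (pairCount-diag i j i≢j a)
                         (sym (trans (cong (C *_) (⟦⟧-false (¬? (toℕ a ≟ℕ toℕ a)) (λ a≢a → a≢a refl))) (*-zeroʳ C)))
  ... | no a≢b   = trans (pairCount-const i j a≢b)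
                         (sym (trans (cong (C *_) (⟦⟧-true (¬? (toℕ a ≟ℕ toℕ b)) (a≢b ∘ toℕ-injective))) (*-identityʳ C)))

  ∑-Perm-columns-pairCount : (f : ℕ → ℕ → ℕ) →
    ∑[ p ∈ Perm (2 + k) ] f (toℕ (lookup p i)) (toℕ (lookup p j))
      ≡ pairCount i j zero (suc zero) * ∑ℕ[ x < 2 + k ] ∑ℕ[ y < 2 + k ] (⟦ ¬? (x ≟ℕ y) ⟧ * f x y)
  ∑-Perm-columns-pairCount f = begin
      ∑[ p ∈ Perm (2 + k) ] f (toℕ (lookup p i)) (toℕ (lookup p j))
    ≡⟨ ∑-fibres₂ (Perm (2 + k)) (λ p → lookup p i) (λ p → lookup p j) (λ a b → f (toℕ a) (toℕ b)) ⟩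
      ∑[ a < 2 + k ] ∑[ b < 2 + k ] (pairCount i j a b * f (toℕ a) (toℕ b))
    ≡⟨ ∑-cong (allFin (2 + k)) (λ a → ∑-cong (allFin (2 + k)) (λ b →
         trans (cong (_* f (toℕ a) (toℕ b)) (pairCount-distinct a b)) (*-assoc C _ _))) ⟩
      ∑[ a < 2 + k ] ∑[ b < 2 + k ] (C * (⟦ ¬? (toℕ a ≟ℕ toℕ b) ⟧ * f (toℕ a) (toℕ b)))
    ≡⟨ ∑-cong (allFin (2 + k)) (λ a → ∑-*ˡ (allFin (2 + k)) C _) ⟩
      ∑[ a < 2 + k ] (C * ∑[ b < 2 + k ] (⟦ ¬? (toℕ a ≟ℕ toℕ b) ⟧ * f (toℕ a) (toℕ b)))
    ≡⟨ ∑-*ˡ (allFin (2 + k)) C _ ⟩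
      C * ∑ℕ[ x < 2 + k ] ∑ℕ[ y < 2 + k ] (⟦ ¬? (x ≟ℕ y) ⟧ * f x y)
    ∎ where open ≡-Reasoning

  pairCount-01 : pairCount i j zero (suc zero) ≡ k !
  pairCount-01 = *-cancelʳ-≡ _ _ ((2 + k) * (1 + k)) (begin
      C * ((2 + k) * (1 + k))
    ≡⟨ cong (C *_) (∑ℕ-distinct (2 + k)) ⟨
      C * ∑ℕ[ x < 2 + k ] ∑ℕ[ y < 2 + k ] ⟦ ¬? (x ≟ℕ y) ⟧
    ≡⟨ cong (C *_) (∑ℕ-cong (2 + k) (λ x _ → ∑ℕ-cong (2 + k) (λ y _ → *-identityʳ ⟦ ¬? (x ≟ℕ y) ⟧))) ⟨
      C * ∑ℕ[ x < 2 + k ] ∑ℕ[ y < 2 + k ] (⟦ ¬? (x ≟ℕ y) ⟧ * 1)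
    ≡⟨ ∑-Perm-columns-pairCount (λ _ _ → 1) ⟨
      ∑[ p ∈ Perm (2 + k) ] 1
    ≡⟨ length≡∑1 (Perm (2 + k)) ⟨
      length (Perm (2 + k))
    ≡⟨ length-Perm (2 + k) ⟩
      (2 + k) !
    ≡⟨ trans (sym (*-assoc (2 + k) (1 + k) (k !))) (*-comm _ (k !)) ⟩
      k ! * ((2 + k) * (1 + k))
    ∎)
    where open ≡-Reasoning

  ∑-Perm-columns : (f : ℕ → ℕ → ℕ) →
    ∑[ p ∈ Perm (2 + k) ] f (toℕ (lookup p i)) (toℕ (lookup p j))
      ≡ k ! * ∑ℕ[ x < 2 + k ] ∑ℕ[ y < 2 + k ] (⟦ ¬? (x ≟ℕ y) ⟧ * f x y)
  ∑-Perm-columns f = trans (∑-Perm-columns-pairCount f) (cong (_* _) pairCount-01)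

-- Levels of pairs of columns

⟦≟⟧-sym : (a b : ℕ) → ⟦ a ≟ℕ b ⟧ ≡ ⟦ b ≟ℕ a ⟧
⟦≟⟧-sym a b = ⟦⟧-⇔ (mk⇔ sym sym) (a ≟ℕ b) (b ≟ℕ a)

⟦≢⟧-sym : (a b : ℕ) → ⟦ ¬? (a ≟ℕ b) ⟧ ≡ ⟦ ¬? (b ≟ℕ a) ⟧
⟦≢⟧-sym a b = ⟦⟧-⇔ (mk⇔ ≢-sym ≢-sym) (¬? (a ≟ℕ b)) (¬? (b ≟ℕ a))

equalLevels⇔ : {x y z w : ℕ} → x < y → (z ≢ w × x ⊔ z ≡ y ⊔ w) ⇔ (y ≡ z × w < y)
equalLevels⇔ {x} {y} {z} {w} x<y = mk⇔ to from
  where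
  to : z ≢ w × x ⊔ z ≡ y ⊔ w → y ≡ z × w < y
  to (z≢w , x⊔z≡y⊔w) with w <? y | ⊔-sel x z
  ... | yes w<y | inj₁ x⊔z≡x = contradiction (trans (sym x⊔z≡x) (trans x⊔z≡y⊔w (m≥n⇒m⊔n≡m (<⇒≤ w<y)))) (<⇒≢ x<y)
  ... | yes w<y | inj₂ x⊔z≡z = sym (trans (sym x⊔z≡z) (trans x⊔z≡y⊔w (m≥n⇒m⊔n≡m (<⇒≤ w<y)))) , w<y
  ... | no w≮y  | inj₁ x⊔z≡x = contradiction (trans (sym x⊔z≡x) (trans x⊔z≡y⊔w (m≤n⇒m⊔n≡n (≮⇒≥ w≮y))))
                                              (<⇒≢ (<-≤-trans x<y (≮⇒≥ w≮y)))
  ... | no w≮y  | inj₂ x⊔z≡z = contradiction (trans (sym x⊔z≡z) (trans x⊔z≡y⊔w (m≤n⇒m⊔n≡n (≮⇒≥ w≮y)))) z≢w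
  from : y ≡ z × w < y → z ≢ w × x ⊔ z ≡ y ⊔ w
  from (refl , w<y) = (λ y≡w → <⇒≢ w<y (sym y≡w))
                    , trans (m≤n⇒m⊔n≡n (<⇒≤ x<y)) (sym (m≥n⇒m⊔n≡m (<⇒≤ w<y)))

plateauCompletions : (n x y : ℕ) → ℕ
plateauCompletions n x y = ∑ℕ[ z < n ] ∑ℕ[ w < n ] (⟦ ¬? (z ≟ℕ w) ⟧ * ⟦ x ⊔ z ≟ℕ y ⊔ w ⟧)

plateauCompletions-< : {n x y : ℕ} → x < y → y < n → plateauCompletions n x y ≡ y
plateauCompletions-< {n} {x} {y} x<y y<n = begin
    plateauCompletions n x y
  ≡⟨ ∑ℕ-cong n (λ z _ → ∑ℕ-cong n (λ w _ → equalLevel-indicator z w)) ⟩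
    ∑ℕ[ z < n ] ∑ℕ[ w < n ] (⟦ y ≟ℕ z ⟧ * ⟦ w <? y ⟧)
  ≡⟨ ∑-cong (allFin n) (λ z → ∑-*ˡ (allFin n) ⟦ y ≟ℕ toℕ z ⟧ _) ⟩
    ∑ℕ[ z < n ] (⟦ y ≟ℕ z ⟧ * ∑ℕ[ w < n ] ⟦ w <? y ⟧)
  ≡⟨ ∑ℕ-δ y<n _ ⟩
    ∑ℕ[ w < n ] ⟦ w <? y ⟧
  ≡⟨ ∑ℕ-< n y ⟩
    n ⊓ y
  ≡⟨ m≥n⇒m⊓n≡n (<⇒≤ y<n) ⟩
    y
  ∎ where
  open ≡-Reasoning
  equalLevel-indicator : ∀ z w → ⟦ ¬? (z ≟ℕ w) ⟧ * ⟦ x ⊔ z ≟ℕ y ⊔ w ⟧ ≡ ⟦ y ≟ℕ z ⟧ * ⟦ w <? y ⟧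
  equalLevel-indicator z w = begin
      ⟦ ¬? (z ≟ℕ w) ⟧ * ⟦ x ⊔ z ≟ℕ y ⊔ w ⟧
    ≡⟨ ⟦⟧-* (¬? (z ≟ℕ w)) (x ⊔ z ≟ℕ y ⊔ w) ⟩
      ⟦ ¬? (z ≟ℕ w) ×-dec (x ⊔ z ≟ℕ y ⊔ w) ⟧
    ≡⟨ ⟦⟧-⇔ (equalLevels⇔ x<y) (¬? (z ≟ℕ w) ×-dec (x ⊔ z ≟ℕ y ⊔ w)) ((y ≟ℕ z) ×-dec (w <? y)) ⟩
      ⟦ (y ≟ℕ z) ×-dec (w <? y) ⟧
    ≡⟨ ⟦⟧-* (y ≟ℕ z) (w <? y) ⟨
      ⟦ y ≟ℕ z ⟧ * ⟦ w <? y ⟧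
    ∎

plateauCompletions-sym : (n x y : ℕ) → plateauCompletions n x y ≡ plateauCompletions n y x
plateauCompletions-sym n x y = trans (∑-swap (allFin n) (allFin n) _)
  (∑-cong (allFin n) (λ w → ∑-cong (allFin n) (λ z →
    cong₂ _*_ (⟦≢⟧-sym (toℕ z) (toℕ w)) (⟦≟⟧-sym (x ⊔ toℕ z) (y ⊔ toℕ w)))))

sumMaxDistinct : ℕ → ℕ
sumMaxDistinct n = ∑ℕ[ x < n ] ∑ℕ[ y < n ] (⟦ ¬? (x ≟ℕ y) ⟧ * (x ⊔ y))

sumMaxDistinct-suc : (n : ℕ) → sumMaxDistinct (suc n) ≡ sumMaxDistinct n + n * n + n * n
sumMaxDistinct-suc n = begin
    sumMaxDistinct (suc n)
  ≡⟨ ∑ℕ-last n (λ x → ∑ℕ[ y < suc n ] g x y) ⟩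
    ∑ℕ[ x < n ] ∑ℕ[ y < suc n ] g x y + ∑ℕ[ y < suc n ] g n y
  ≡⟨ cong₂ _+_ (∑-cong (allFin n) (λ x → ∑ℕ-last n (g (toℕ x)))) (∑ℕ-last n (g n)) ⟩
    ∑ℕ[ x < n ] (∑ℕ[ y < n ] g x y + g x n) + (∑ℕ[ y < n ] g n y + g n n)
  ≡⟨ cong₂ _+_ (∑-distrib-+ (allFin n) _ _) (cong₂ _+_ (∑ℕ-cong n last-row) g-diag) ⟩
    sumMaxDistinct n + ∑ℕ[ x < n ] g x n + (∑ℕ[ y < n ] n + 0)
  ≡⟨ cong₂ _+_ (cong (sumMaxDistinct n +_) (trans (∑ℕ-cong n last-column) (∑<-const n n))) (+-identityʳ _) ⟩
    sumMaxDistinct n + n * n + ∑ℕ[ y < n ] n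
  ≡⟨ cong (sumMaxDistinct n + n * n +_) (∑<-const n n) ⟩
    sumMaxDistinct n + n * n + n * n
  ∎ where
  open ≡-Reasoning
  g : ℕ → ℕ → ℕ
  g x y = ⟦ ¬? (x ≟ℕ y) ⟧ * (x ⊔ y)
  g-diag : g n n ≡ 0
  g-diag = cong (_* (n ⊔ n)) (⟦⟧-false (¬? (n ≟ℕ n)) (λ n≢n → n≢n refl))
  last-column : ∀ x → x < n → g x n ≡ n
  last-column x x<n = trans (cong₂ _*_ (⟦⟧-true (¬? (x ≟ℕ n)) (<⇒≢ x<n)) (m≤n⇒m⊔n≡n (<⇒≤ x<n))) (+-identityʳ n)
  last-row : ∀ y → y < n → g n y ≡ n
  last-row y y<n = trans (cong₂ _*_ (⟦⟧-true (¬? (n ≟ℕ y)) (≢-sym (<⇒≢ y<n))) (m≥n⇒m⊔n≡m (<⇒≤ y<n))) (+-identityʳ n)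

sumMaxDistinct-closed : (k : ℕ) → 3 * sumMaxDistinct (suc k) ≡ (2 * k + 1) * suc k * k
sumMaxDistinct-closed zero    = refl
sumMaxDistinct-closed (suc k) = begin
    3 * sumMaxDistinct (2 + k)
  ≡⟨ cong (3 *_) (sumMaxDistinct-suc (suc k)) ⟩
    3 * (sumMaxDistinct (suc k) + suc k * suc k + suc k * suc k)
  ≡⟨ distribute (sumMaxDistinct (suc k)) k ⟩
    3 * sumMaxDistinct (suc k) + 6 * (suc k * suc k)
  ≡⟨ cong (_+ 6 * (suc k * suc k)) (sumMaxDistinct-closed k) ⟩
    (2 * k + 1) * suc k * k + 6 * (suc k * suc k)
  ≡⟨ collect k ⟩
    (2 * suc k + 1) * (2 + k) * suc k
  ∎ where
  open ≡-Reasoning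
  distribute : ∀ s k → 3 * (s + suc k * suc k + suc k * suc k) ≡ 3 * s + 6 * (suc k * suc k)
  distribute = solve-∀
  collect : ∀ k → (2 * k + 1) * suc k * k + 6 * (suc k * suc k) ≡ (2 * suc k + 1) * (2 + k) * suc k
  collect = solve-∀

-- The two columns are (x, z) and (y, w), with x, y in row π² and z, w in row π³.
relatedColumnPairs : (ℕ → ℕ → Bool) → ℕ → ℕ
relatedColumnPairs r n =
  ∑ℕ[ x < n ] ∑ℕ[ y < n ] (⟦ ¬? (x ≟ℕ y) ⟧ * ∑ℕ[ z < n ] ∑ℕ[ w < n ] (⟦ ¬? (z ≟ℕ w) ⟧ * 𝟙 (r (x ⊔ z) (y ⊔ w))))

relatedColumnPairs-flip : (r : ℕ → ℕ → Bool) (n : ℕ) → relatedColumnPairs r n ≡ relatedColumnPairs (flip r) n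
relatedColumnPairs-flip r n = trans (∑-swap (allFin n) (allFin n) _)
  (∑-cong (allFin n) (λ y → ∑-cong (allFin n) (λ x →
    cong₂ _*_ (⟦≢⟧-sym (toℕ x) (toℕ y))
              (trans (∑-swap (allFin n) (allFin n) _)
                     (∑-cong (allFin n) (λ w → ∑-cong (allFin n) (λ z →
                       cong (_* 𝟙 (r (toℕ x ⊔ toℕ z) (toℕ y ⊔ toℕ w))) (⟦≢⟧-sym (toℕ z) (toℕ w)))))))))

relatedColumnPairs-plateau : (n : ℕ) → relatedColumnPairs _≡ᵇ_ n ≡ sumMaxDistinct n
relatedColumnPairs-plateau n = ∑ℕ-cong n (λ x x<n → ∑ℕ-cong n (λ y y<n → weighted x y x<n y<n))
  where
  weighted : ∀ x y → x < n → y < n → ⟦ ¬? (x ≟ℕ y) ⟧ * plateauCompletions n x y ≡ ⟦ ¬? (x ≟ℕ y) ⟧ * (x ⊔ y)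
  weighted x y x<n y<n with <-cmp x y
  ... | tri< x<y _ _ = cong (⟦ ¬? (x ≟ℕ y) ⟧ *_) (trans (plateauCompletions-< x<y y<n) (sym (m≤n⇒m⊔n≡n (<⇒≤ x<y))))
  ... | tri≈ _ refl _ = trans (cong (_* plateauCompletions n x x) ⟦x≢x⟧≡0) (sym (cong (_* (x ⊔ x)) ⟦x≢x⟧≡0))
    where ⟦x≢x⟧≡0 = ⟦⟧-false (¬? (x ≟ℕ x)) (λ x≢x → x≢x refl)
  ... | tri> _ _ y<x = cong (⟦ ¬? (x ≟ℕ y) ⟧ *_)
                         (trans (plateauCompletions-sym n x y) (trans (plateauCompletions-< y<x x<n) (sym (m≥n⇒m⊔n≡m (<⇒≤ y<x)))))

-- Totals over S³ₙ

inject₁≢suc : {k : ℕ} (i : Fin k) → inject₁ i ≢ suc i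
inject₁≢suc zero    ()
inject₁≢suc (suc i) e = inject₁≢suc i (suc-injective e)

countAdj-tabulate : (r : ℕ → ℕ → Bool) (k : ℕ) (g : Fin (suc k) → ℕ) →
                    countAdj r (tabulate g) ≡ ∑[ i < k ] 𝟙 (r (g (inject₁ i)) (g (suc i)))
countAdj-tabulate r zero    g = refl
countAdj-tabulate r (suc k) g = trans (cong (𝟙 (r (g zero) (g (suc zero))) +_) (countAdj-tabulate r k (g ∘ suc)))
                                      (sym (∑<-suc k (λ i → 𝟙 (r (g (inject₁ i)) (g (suc i))))))

countAdj-trichotomy : (xs : List ℕ) →
  countAdj _≡ᵇ_ xs + countAdj _<ᵇ_ xs + countAdj (flip _<ᵇ_) xs ≡ length xs ∸ 1
countAdj-trichotomy []           = refl
countAdj-trichotomy (a ∷ [])     = refl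
countAdj-trichotomy (a ∷ b ∷ xs) =
  trans (regroup ⟦ a ≟ℕ b ⟧ ⟦ a <? b ⟧ ⟦ b <? a ⟧ _ _ _)
        (cong₂ _+_ (trichotomy-indicator a b) (countAdj-trichotomy (b ∷ xs)))
  where
  regroup : ∀ p q r P Q R → p + P + (q + Q) + (r + R) ≡ p + q + r + (P + Q + R)
  regroup = solve-∀
  trichotomy-indicator : (a b : ℕ) → ⟦ a ≟ℕ b ⟧ + ⟦ a <? b ⟧ + ⟦ b <? a ⟧ ≡ 1
  trichotomy-indicator a b with <-cmp a b
  ... | tri< a<b a≢b _ = cong₂ _+_ (cong₂ _+_ (⟦⟧-false (a ≟ℕ b) a≢b) (⟦⟧-true (a <? b) a<b)) (⟦⟧-false (b <? a) (<-asym a<b))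
  ... | tri≈ _ a≡b _   = cong₂ _+_ (cong₂ _+_ (⟦⟧-true (a ≟ℕ b) a≡b) (⟦⟧-false (a <? b) (<-irrefl a≡b))) (⟦⟧-false (b <? a) (<-irrefl (sym a≡b)))
  ... | tri> _ a≢b b<a = cong₂ _+_ (cong₂ _+_ (⟦⟧-false (a ≟ℕ b) a≢b) (⟦⟧-false (a <? b) (<-asym b<a))) (⟦⟧-true (b <? a) b<a)

countAdj-levels : (r : ℕ → ℕ → Bool) {k : ℕ} (Π : Vec (Fin (suc k)) (suc k) × Vec (Fin (suc k)) (suc k)) →
                  countAdj r (levels Π) ≡ ∑[ i < k ] 𝟙 (r (lev Π (inject₁ i)) (lev Π (suc i)))
countAdj-levels r {k} Π = trans (cong (countAdj r) (map-tabulate id (lev Π))) (countAdj-tabulate r k (lev Π))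

length-levels : {n : ℕ} (Π : Vec (Fin n) n × Vec (Fin n) n) → length (levels Π) ≡ n
length-levels {n} Π = trans (length-map (lev Π) (allFin n)) (length-tabulate {n = n} id)

length-S3 : (n : ℕ) → length (S3 n) ≡ n ! * n !
length-S3 n = begin
    length (S3 n)
  ≡⟨ length≡∑1 (S3 n) ⟩
    ∑[ Π ∈ S3 n ] 1
  ≡⟨ ∑-cartesianProduct (Perm n) (Perm n) _ ⟩
    ∑[ p ∈ Perm n ] ∑[ q ∈ Perm n ] 1
  ≡⟨ ∑-cong (Perm n) (λ _ → trans (sym (length≡∑1 (Perm n))) (length-Perm n)) ⟩
    ∑[ p ∈ Perm n ] (n !)
  ≡⟨ ∑-const (Perm n) (n !) ⟩
    length (Perm n) * n !
  ≡⟨ cong (_* n !) (length-Perm n) ⟩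
    n ! * n !
  ∎ where open ≡-Reasoning

∑-S3-columns : {k : ℕ} (i j : Fin (2 + k)) → i ≢ j → (r : ℕ → ℕ → Bool) →
               ∑[ Π ∈ S3 (2 + k) ] 𝟙 (r (lev Π i) (lev Π j)) ≡ k ! * (k ! * relatedColumnPairs r (2 + k))
∑-S3-columns {k} i j i≢j r = begin
    ∑[ Π ∈ S3 (2 + k) ] 𝟙 (r (lev Π i) (lev Π j))
  ≡⟨ ∑-cartesianProduct (Perm (2 + k)) (Perm (2 + k)) _ ⟩
    ∑[ p ∈ Perm (2 + k) ] ∑[ q ∈ Perm (2 + k) ] 𝟙 (r (toℕ (lookup p i) ⊔ toℕ (lookup q i)) (toℕ (lookup p j) ⊔ toℕ (lookup q j)))
  ≡⟨ ∑-cong (Perm (2 + k)) (λ p → ∑-Perm-columns i j i≢j (λ z w → 𝟙 (r (toℕ (lookup p i) ⊔ z) (toℕ (lookup p j) ⊔ w)))) ⟩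
    ∑[ p ∈ Perm (2 + k) ] (k ! * G (toℕ (lookup p i)) (toℕ (lookup p j)))
  ≡⟨ ∑-*ˡ (Perm (2 + k)) (k !) _ ⟩
    k ! * ∑[ p ∈ Perm (2 + k) ] G (toℕ (lookup p i)) (toℕ (lookup p j))
  ≡⟨ cong (k ! *_) (∑-Perm-columns i j i≢j G) ⟩
    k ! * (k ! * relatedColumnPairs r (2 + k))
  ∎ where
  open ≡-Reasoning
  G : ℕ → ℕ → ℕ
  G x y = ∑ℕ[ z < 2 + k ] ∑ℕ[ w < 2 + k ] (⟦ ¬? (z ≟ℕ w) ⟧ * 𝟙 (r (x ⊔ z) (y ⊔ w)))

-- totalPlateaux, totalAscents and totalDescents are adjacentTotal at _≡ᵇ_, _<ᵇ_ and flip _<ᵇ_.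
adjacentTotal : (ℕ → ℕ → Bool) → ℕ → ℕ
adjacentTotal r n = ∑[ Π ∈ S3 n ] countAdj r (levels Π)

adjacentTotal-formula : (r : ℕ → ℕ → Bool) (k : ℕ) →
                        adjacentTotal r (2 + k) ≡ suc k * (k ! * (k ! * relatedColumnPairs r (2 + k)))
adjacentTotal-formula r k = begin
    adjacentTotal r (2 + k)
  ≡⟨ ∑-cong (S3 (2 + k)) (countAdj-levels r) ⟩
    ∑[ Π ∈ S3 (2 + k) ] ∑[ i < suc k ] 𝟙 (r (lev Π (inject₁ i)) (lev Π (suc i)))
  ≡⟨ ∑-swap (S3 (2 + k)) (allFin (suc k)) _ ⟩
    ∑[ i < suc k ] ∑[ Π ∈ S3 (2 + k) ] 𝟙 (r (lev Π (inject₁ i)) (lev Π (suc i)))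
  ≡⟨ ∑-cong (allFin (suc k)) (λ i → ∑-S3-columns (inject₁ i) (suc i) (inject₁≢suc i) r) ⟩
    ∑[ i < suc k ] (k ! * (k ! * relatedColumnPairs r (2 + k)))
  ≡⟨ ∑<-const (suc k) _ ⟩
    suc k * (k ! * (k ! * relatedColumnPairs r (2 + k)))
  ∎ where open ≡-Reasoning

adjacentTotal-trichotomy : (n : ℕ) →
  adjacentTotal _≡ᵇ_ n + adjacentTotal _<ᵇ_ n + adjacentTotal (flip _<ᵇ_) n ≡ n ! * n ! * (n ∸ 1)
adjacentTotal-trichotomy n = begin
    adjacentTotal _≡ᵇ_ n + adjacentTotal _<ᵇ_ n + adjacentTotal (flip _<ᵇ_) n
  ≡⟨ cong (_+ adjacentTotal (flip _<ᵇ_) n) (∑-distrib-+ (S3 n) _ _) ⟨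
    ∑[ Π ∈ S3 n ] (countAdj _≡ᵇ_ (levels Π) + countAdj _<ᵇ_ (levels Π)) + adjacentTotal (flip _<ᵇ_) n
  ≡⟨ ∑-distrib-+ (S3 n) _ _ ⟨
    ∑[ Π ∈ S3 n ] (countAdj _≡ᵇ_ (levels Π) + countAdj _<ᵇ_ (levels Π) + countAdj (flip _<ᵇ_) (levels Π))
  ≡⟨ ∑-cong (S3 n) (λ Π → trans (countAdj-trichotomy (levels Π)) (cong (_∸ 1) (length-levels Π))) ⟩
    ∑[ Π ∈ S3 n ] (n ∸ 1)
  ≡⟨ ∑-const (S3 n) (n ∸ 1) ⟩
    length (S3 n) * (n ∸ 1)
  ≡⟨ cong (_* (n ∸ 1)) (length-S3 n) ⟩
    n ! * n ! * (n ∸ 1)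
  ∎ where open ≡-Reasoning

totalAscents≡totalDescents : (n : ℕ) → 2 ≤ n → totalAscents n ≡ totalDescents n
totalAscents≡totalDescents (suc (suc k)) (s≤s (s≤s z≤n)) = begin
    adjacentTotal _<ᵇ_ (2 + k)
  ≡⟨ adjacentTotal-formula _<ᵇ_ k ⟩
    suc k * (k ! * (k ! * relatedColumnPairs _<ᵇ_ (2 + k)))
  ≡⟨ cong (λ q → suc k * (k ! * (k ! * q))) (relatedColumnPairs-flip _<ᵇ_ (2 + k)) ⟩
    suc k * (k ! * (k ! * relatedColumnPairs (flip _<ᵇ_) (2 + k)))
  ≡⟨ adjacentTotal-formula (flip _<ᵇ_) k ⟨
    adjacentTotal (flip _<ᵇ_) (2 + k)
  ∎ where open ≡-Reasoning

2[2+k]∸1 : (k : ℕ) → 2 * (2 + k) ∸ 1 ≡ 2 * k + 3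
2[2+k]∸1 k = trans (cong (_∸ 1) (shift k)) (m+n∸n≡m (2 * k + 3) 1)
  where
  shift : ∀ k → 2 * (2 + k) ≡ 2 * k + 3 + 1
  shift = solve-∀

3[2+k]²+1∸5[2+k] : (k : ℕ) → 3 * (2 + k) * (2 + k) + 1 ∸ 5 * (2 + k) ≡ 3 * k * k + 7 * k + 3
3[2+k]²+1∸5[2+k] k = trans (cong (_∸ 5 * (2 + k)) (shift k)) (m+n∸n≡m (3 * k * k + 7 * k + 3) (5 * (2 + k)))
  where
  shift : ∀ k → 3 * (2 + k) * (2 + k) + 1 ≡ 3 * k * k + 7 * k + 3 + 5 * (2 + k)
  shift = solve-∀

totalPlateaux-formula : (n : ℕ) → 2 ≤ n → 3 * totalPlateaux n ≡ (2 * n ∸ 1) * n ! * (n ∸ 1) !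
totalPlateaux-formula (suc (suc k)) (s≤s (s≤s z≤n)) = begin
    3 * adjacentTotal _≡ᵇ_ (2 + k)
  ≡⟨ cong (3 *_) (adjacentTotal-formula _≡ᵇ_ k) ⟩
    3 * (suc k * (k ! * (k ! * relatedColumnPairs _≡ᵇ_ (2 + k))))
  ≡⟨ pull-out-3 k (k !) _ ⟩
    suc k * k ! * k ! * (3 * relatedColumnPairs _≡ᵇ_ (2 + k))
  ≡⟨ cong (λ q → suc k * k ! * k ! * (3 * q)) (relatedColumnPairs-plateau (2 + k)) ⟩
    suc k * k ! * k ! * (3 * sumMaxDistinct (2 + k))
  ≡⟨ cong (suc k * k ! * k ! *_) (sumMaxDistinct-closed (suc k)) ⟩
    suc k * k ! * k ! * ((2 * suc k + 1) * (2 + k) * suc k)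
  ≡⟨ collect k (k !) ⟩
    (2 * k + 3) * (2 + k) ! * (suc k) !
  ≡⟨ cong (λ c → c * (2 + k) ! * (suc k) !) (2[2+k]∸1 k) ⟨
    (2 * (2 + k) ∸ 1) * (2 + k) ! * (suc k) !
  ∎ where
  open ≡-Reasoning
  pull-out-3 : ∀ k f q → 3 * (suc k * (f * (f * q))) ≡ suc k * f * f * (3 * q)
  pull-out-3 = solve-∀
  collect : ∀ k f → suc k * f * f * ((2 * suc k + 1) * (2 + k) * suc k) ≡ (2 * k + 3) * ((2 + k) * (suc k * f)) * (suc k * f)
  collect = solve-∀

totalAscents-formula : (n : ℕ) → 2 ≤ n → 6 * totalAscents n ≡ (3 * n * n + 1 ∸ 5 * n) * n ! * (n ∸ 1) !
totalAscents-formula n@(suc (suc k)) 2≤n@(s≤s (s≤s z≤n)) = +-cancelʳ-≡ (3 * totalPlateaux n) _ _ (begin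
    6 * totalAscents n + 3 * totalPlateaux n
  ≡⟨ regroup (totalPlateaux n) (totalAscents n) ⟩
    3 * (totalPlateaux n + totalAscents n + totalAscents n)
  ≡⟨ cong (λ d → 3 * (totalPlateaux n + totalAscents n + d)) (totalAscents≡totalDescents n 2≤n) ⟩
    3 * (totalPlateaux n + totalAscents n + totalDescents n)
  ≡⟨ cong (3 *_) (adjacentTotal-trichotomy n) ⟩
    3 * (n ! * n ! * suc k)
  ≡⟨ split k (k !) ⟩
    (3 * k * k + 7 * k + 3) * n ! * (suc k) ! + (2 * k + 3) * n ! * (suc k) !
  ≡⟨ cong₂ (λ c d → c * n ! * (suc k) ! + d * n ! * (suc k) !) (3[2+k]²+1∸5[2+k] k) (2[2+k]∸1 k) ⟨
    (3 * n * n + 1 ∸ 5 * n) * n ! * (suc k) ! + (2 * n ∸ 1) * n ! * (suc k) !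
  ≡⟨ cong ((3 * n * n + 1 ∸ 5 * n) * n ! * (suc k) ! +_) (totalPlateaux-formula n 2≤n) ⟨
    (3 * n * n + 1 ∸ 5 * n) * n ! * (suc k) ! + 3 * totalPlateaux n
  ∎)
  where
  open ≡-Reasoning
  regroup : ∀ p a → 6 * a + 3 * p ≡ 3 * (p + a + a)
  regroup = solve-∀
  split : ∀ k f → 3 * ((2 + k) * (suc k * f) * ((2 + k) * (suc k * f)) * suc k)
                  ≡ (3 * k * k + 7 * k + 3) * ((2 + k) * (suc k * f)) * (suc k * f) + (2 * k + 3) * ((2 + k) * (suc k * f)) * (suc k * f)
  split = solve-∀

corollary3p16 : (n : ℕ) → 2 ≤ n →
    (3 * totalPlateaux n ≡ (2 * n ∸ 1) * (n !) * ((n ∸ 1) !))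
    × (6 * totalAscents n ≡ (3 * n * n + 1 ∸ 5 * n) * (n !) * ((n ∸ 1) !))
    × (totalAscents n ≡ totalDescents n)
corollary3p16 n 2≤n = totalPlateaux-formula n 2≤n , totalAscents-formula n 2≤n , totalAscents≡totalDescents n 2≤n
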